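{- Let $f:F\to F'$ be a homomorphism of tracts and let $M$ be a strong (resp. weak) $F$-matroid on a finite set $E$ with $F$-circuit set $\mathcal C(M)$. Then $\{c'\,f_*(X): c'\in(F')^\times,\ X\in\mathcal C(M)\}$ is the set of $F'$-circuits of a strong (resp. weak) $F'$-matroid on $E$, where $f_*(X)\in (F')^E$ is given by $f_*(X)(e)=f(X(e))$.
   Context: A tract $F=(G,N_G)$: an abelian group $G$ (multiplicative) with $N_G\subseteq\mathbb N[G]$ satisfying (T0) $0\in N_G$; (T1) $1\notin N_G$; (T2) a unique $\epsilon\in G$ has $1+\epsilon\in N_G$; (T3) $GN_G\subseteq N_G$. $F=G\cup\{0\}$, $F^\times=G$, $-x=\epsilon x$; sums of elements of $F$ are taken in $\mathbb N[G]$ omitting zeros. A homomorphism $f:(G,N_G)\to(G',N_{G'})$ is a group homomorphism $f:G\to G'$, extended by $f(0)=0$ and to $\mathbb N[G]\to\mathbb N[G']$ by $f(\sum a_ig_i)=\sum a_if(g_i)$, such that $f(N_G)\subseteq N_{G'}$. Support $\underline X=\{e:X(e)\ne0\}$. Weak $F$-matroid: $\mathcal C\subseteq F^E$ with (C0) $0\notin\mathcal C$; (C1) $F^\times\mathcal C\subseteq\mathcal C$; (C2) $\underline X\subseteq\underline Y\Rightarrow X=\alpha Y$, $\alpha\in F^\times$; (C3)' if $X,Y\in\mathcal C$ form a modular pair ($\underline X\ne\underline Y$ and $\underline X\cup\underline Y$ does not properly contain a union of two distinct supports of elements of $\mathcal C$) and $X(e)=-Y(e)\ne0$, there is $Z\in\mathcal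 C$ with $Z(e)=0$ and $X(f)+Y(f)-Z(f)\in N_G$ for all $f$. Strong: (C0)–(C2) and (C3): whenever $X_1,\dots,X_k,X\in\mathcal C$ form a modular family of size $k+1$ (union of supports has height $k+1$ in the inclusion-ordered set of unions of supports of elements of $\mathcal C$, height = maximal length of a strict chain ending there) with $\underline X\not\subseteq\bigcup\underline X_i$, and $e_i\in(\underline X\cap\underline X_i)\setminus\bigcup_{j\ne i}\underline X_j$ with $X(e_i)=-X_i(e_i)\ne0$, there is $Z\in\mathcal C$ with $Z(e_i)=0$ for all $i$ and $X_1(f)+\dots+X_k(f)+X(f)-Z(f)\in N_G$ for all $f$. -}

module Defs where

open import Level using (0ℓ)
open import Data.Nat using (ℕ; zero; suc)
open import Data.Fin using (Fin)
open import Data.Fin.Subset using (Subset; inside; outside; _∈_; _∉_; _⊆_; _⊂_; _∪_; ⋃)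
open import Data.Bool using (Bool; true; false)
open import Data.Maybe using (Maybe; just; nothing; is-just)
import Data.Maybe as Maybe
open import Data.List using (List; []; _∷_; _++_; catMaybes)
import Data.List as List
open import Data.List.Relation.Unary.All using (All)
open import Data.List.Relation.Binary.Permutation.Propositional using (_↭_)
open import Data.Vec using (Vec; lookup)
import Data.Vec as Vec
open import Data.Product using (Σ; ∃; ∃-syntax; _×_; _,_)
open import Relation.Nullary using (¬_)
open import Relation.Binary.PropositionalEquality using (_≡_; _≢_)
open import Algebra.Structures using (IsAbelianGroup)

-- Tracts.  ℕ[G] is represented by lists over G (a formal sum, with
-- multiplicities given by repetitions); N is required to be invariant
-- under permutation, so it is really a subset of ℕ[G].

record Tract : Set₁ where
  field
    G      : Set
    _·_    : G → G → G
    one    : G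
    inv    : G → G
    isAbelianGroup : IsAbelianGroup _≡_ _·_ one inv
    N      : List G → Set
    N-perm : ∀ {xs ys} → xs ↭ ys → N xs → N ys
    T0     : N []
    T1     : ¬ N (one ∷ [])
    ε      : G
    T2     : N (one ∷ ε ∷ [])
    T2-unique : ∀ g → N (one ∷ g ∷ []) → g ≡ ε
    T3     : ∀ g xs → N xs → N (List.map (g ·_) xs)

  -- elements of F = G ∪ {0}: nothing is 0
  F : Set
  F = Maybe G

  neg : F → F
  neg = Maybe.map (ε ·_)

  -- a sum of elements of F, omitting zeros, lies in N_G
  NF : List F → Set
  NF xs = N (catMaybes xs)

  scale : ∀ {n} → G → Vec F n → Vec F n
  scale α = Vec.map (Maybe.map (α ·_))

open Tract public

record TractHom (T T' : Tract) : Set where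
  field
    fun    : G T → G T'
    fun-·  : ∀ x y → fun (_·_ T x y) ≡ _·_ T' (fun x) (fun y)
    fun-N  : ∀ xs → N T xs → N T' (List.map fun xs)

open TractHom public

push : ∀ {T T' n} → TractHom T T' → Vec (F T) n → Vec (F T') n
push f = Vec.map (Maybe.map (fun f))

support : ∀ {A : Set} {n} → Vec (Maybe A) n → Subset n
support = Vec.map (λ x → if-just x)
  where
    if-just : ∀ {A : Set} → Maybe A → Bool
    if-just (just _) = true
    if-just nothing  = false

module _ (T : Tract) {n : ℕ} (C : Vec (F T) n → Set) where

  C0 : Set
  C0 = ¬ C (Vec.replicate n nothing)

  C1 : Set
  C1 = ∀ α X → C X → C (scale T α X)

  C2 : Set
  C2 = ∀ X Y → C X → C Y → support X ⊆ support Y → ∃[ α ] X ≡ scale T α Y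

  ModularPair : Vec (F T) n → Vec (F T) n → Set
  ModularPair X Y =
    support X ≢ support Y ×
    ¬ (∃[ X' ] ∃[ Y' ] (C X' × C Y' × support X' ≢ support Y' ×
         (support X' ∪ support Y') ⊂ (support X ∪ support Y)))

  C3w : Set
  C3w = ∀ X Y (e : Fin n) → C X → C Y → ModularPair X Y →
        lookup X e ≡ neg T (lookup Y e) → lookup X e ≢ nothing →
        ∃[ Z ] (C Z × lookup Z e ≡ nothing ×
          (∀ f → NF T (lookup X f ∷ lookup Y f ∷ neg T (lookup Z f) ∷ [])))

  -- unions of supports of (finitely many) elements of C; the empty union ∅ included
  IsUnion : Subset n → Set
  IsUnion S = ∃[ Xs ] (All C Xs × S ≡ ⋃ (List.map support Xs))

  data Chain : Subset n → ℕ → Set where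
    base : ∀ {S} → IsUnion S → Chain S zero
    step : ∀ {S S' m} → Chain S m → IsUnion S' → S ⊂ S' → Chain S' (suc m)

  HasHeight : Subset n → ℕ → Set
  HasHeight S h = Chain S h × (∀ m → Chain S m → m Data.Nat.≤ h)

  C3 : Set
  C3 = ∀ (k : ℕ) (Xs : Fin k → Vec (F T) n) (X : Vec (F T) n) (es : Fin k → Fin n) →
       (∀ i → C (Xs i)) → C X →
       let U = ⋃ (List.tabulate (λ i → support (Xs i))) in
       HasHeight (U ∪ support X) (suc k) →
       ¬ (support X ⊆ U) →
       (∀ i → es i ∈ support X × es i ∈ support (Xs i) ×
              (∀ j → j ≢ i → es i ∉ support (Xs j))) →
       (∀ i → lookup X (es i) ≡ neg T (lookup (Xs i) (es i)) × lookup X (es i) ≢ nothing) →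
       ∃[ Z ] (C Z × (∀ i → lookup Z (es i) ≡ nothing) ×
         (∀ f → NF T (List.tabulate (λ i → lookup (Xs i) f) ++
                        (lookup X f ∷ neg T (lookup Z f) ∷ []))))

  IsStrongMatroid : Set
  IsStrongMatroid = C0 × C1 × C2 × C3

  IsWeakMatroid : Set
  IsWeakMatroid = C0 × C1 × C2 × C3w

pushCircuits : ∀ {T T' n} → TractHom T T' → (Vec (F T) n → Set) → Vec (F T') n → Set
pushCircuits {T' = T'} f C Y = ∃[ c' ] ∃[ X ] (C X × Y ≡ scale T' c' (push f X))

module Submission where

-- Every F'-circuit is c f_*(X) for an F-circuit X with the same support, so both circuit
-- sets have the same supports, unions of supports, chains and heights, hence the same
-- modular pairs and families.  For elimination, an F'-circuit opposite to c f_*(X) at e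
-- can be rewritten as c f_*(αY) with αY an F-circuit opposite to X at e; eliminating in F
-- and applying u ↦ c f(u), which maps N_G into N_G', gives the elimination in F'.

open import Defs
open import Data.Nat using (ℕ; suc)
open import Data.Vec using (Vec)
open import Data.Product using (_×_)

open import Level using (0ℓ)
open import Algebra.Bundles using (AbelianGroup)
import Algebra.Properties.AbelianGroup as AbelianGroupProperties
import Algebra.Properties.CommutativeSemigroup as CommutativeSemigroupProperties
open import Data.Empty using (⊥-elim)
open import Data.Fin using (Fin)
open import Data.Fin.Subset using (_∪_; ⋃; _⊆_; _⊂_; _∈_; _∉_)
open import Data.List using ([]; _∷_; _++_)
import Data.List as List
open import Data.List.Properties using (map-∘; map-catMaybes; map-++; map-tabulate; tabulate-cong)
open import Data.List.Relation.Unary.All using (All; []; _∷_)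
open import Data.Maybe using (Maybe; just; nothing)
import Data.Maybe as Maybe
open import Data.Maybe.Properties using (just-injective)
open import Data.Product using (∃-syntax; _,_; proj₁; proj₂)
open import Data.Vec using ([]; _∷_; lookup)
import Data.Vec as Vec
open import Data.Vec.Properties using (lookup-map; ∷-injectiveʳ)
open import Function using (_∘_)
open import Relation.Nullary using (¬_)
open import Relation.Binary.PropositionalEquality

abelianGroup : Tract → AbelianGroup 0ℓ 0ℓ
abelianGroup T = record
  { Carrier = G T ; _≈_ = _≡_ ; _∙_ = _·_ T ; ε = one T ; _⁻¹ = inv T
  ; isAbelianGroup = isAbelianGroup T
  }

support-map : ∀ {A B : Set} {n} (g : A → B) (X : Vec (Maybe A) n) →
              support (Vec.map (Maybe.map g) X) ≡ support X
support-map g []            = refl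
support-map g (nothing ∷ X) = cong (_ ∷_) (support-map g X)
support-map g (just x ∷ X)  = cong (_ ∷_) (support-map g X)

map-map≡nothings⇒≡nothings : ∀ {A B : Set} {n} (g : A → B) (X : Vec (Maybe A) n) →
  Vec.map (Maybe.map g) X ≡ Vec.replicate n nothing → X ≡ Vec.replicate n nothing
map-map≡nothings⇒≡nothings g []            _  = refl
map-map≡nothings⇒≡nothings g (just x ∷ X)  ()
map-map≡nothings⇒≡nothings g (nothing ∷ X) eq =
  cong (nothing ∷_) (map-map≡nothings⇒≡nothings g X (∷-injectiveʳ eq))

NF-map : ∀ {T T'} (g : G T → G T') → (∀ xs → N T xs → N T' (List.map g xs)) →
         ∀ xs → NF T xs → NF T' (List.map (Maybe.map g) xs)
NF-map {T' = T'} g g-N xs xs∈N = subst (N T') (map-catMaybes g xs) (g-N _ xs∈N)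

module _ {T T' : Tract} (f : TractHom T T') where

  private
    infixl 7 _*_ _⊙_
    _*_ = _·_ T
    _⊙_ = _·_ T'
    φ   = fun f
    module G  = AbelianGroupProperties (abelianGroup T)
    module G' = AbelianGroupProperties (abelianGroup T')
    module G'ᶜ = CommutativeSemigroupProperties (AbelianGroup.commutativeSemigroup (abelianGroup T'))
    open AbelianGroup (abelianGroup T') using () renaming (assoc to ⊙-assoc; identityˡ to ⊙-identityˡ)
    open AbelianGroup (abelianGroup T) using () renaming (identityˡ to *-identityˡ)

  fun-one : φ (one T) ≡ one T'
  fun-one = G'.∙-cancelʳ (φ (one T)) (φ (one T)) (one T') (begin
    φ (one T) ⊙ φ (one T)  ≡⟨ fun-· f (one T) (one T) ⟨
    φ (one T * one T)      ≡⟨ cong φ (*-identityˡ (one T)) ⟩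
    φ (one T)              ≡⟨ ⊙-identityˡ (φ (one T)) ⟨
    one T' ⊙ φ (one T)     ∎)
    where open ≡-Reasoning

  fun-ε : φ (ε T) ≡ ε T'
  fun-ε = T2-unique T' (φ (ε T))
    (subst (λ u → N T' (u ∷ φ (ε T) ∷ [])) fun-one (fun-N f _ (T2 T)))

  ⊙-fun-ε : ∀ c w → c ⊙ φ (ε T * w) ≡ ε T' ⊙ (c ⊙ φ w)
  ⊙-fun-ε c w = begin
    c ⊙ φ (ε T * w)      ≡⟨ cong (c ⊙_) (fun-· f (ε T) w) ⟩
    c ⊙ (φ (ε T) ⊙ φ w)  ≡⟨ cong (λ u → c ⊙ (u ⊙ φ w)) fun-ε ⟩
    c ⊙ (ε T' ⊙ φ w)     ≡⟨ G'ᶜ.x∙yz≈y∙xz c (ε T') (φ w) ⟩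
    ε T' ⊙ (c ⊙ φ w)     ∎
    where open ≡-Reasoning

  scaled : G T' → F T → F T'
  scaled c = Maybe.map (c ⊙_) ∘ Maybe.map φ

  scaledPush : ∀ {n} → G T' → Vec (F T) n → Vec (F T') n
  scaledPush c X = scale T' c (push f X)

  lookup-scaledPush : ∀ {n} c (X : Vec (F T) n) e → lookup (scaledPush c X) e ≡ scaled c (lookup X e)
  lookup-scaledPush c X e =
    trans (lookup-map e _ (push f X)) (cong (Maybe.map (c ⊙_)) (lookup-map e _ X))

  support-scaledPush : ∀ {n} c (X : Vec (F T) n) → support (scaledPush c X) ≡ support X
  support-scaledPush c X = trans (support-map (c ⊙_) (push f X)) (support-map φ X)

  scale-scaledPush : ∀ {n} α c (X : Vec (F T) n) → scale T' α (scaledPush c X) ≡ scaledPush (α ⊙ c) X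
  scale-scaledPush α c []            = refl
  scale-scaledPush α c (nothing ∷ X) = cong (nothing ∷_) (scale-scaledPush α c X)
  scale-scaledPush α c (just x ∷ X)  =
    cong₂ _∷_ (cong just (sym (⊙-assoc α c (φ x)))) (scale-scaledPush α c X)

  scaledPush-scale : ∀ {n} c α (X : Vec (F T) n) → scaledPush c (scale T α X) ≡ scaledPush (c ⊙ φ α) X
  scaledPush-scale c α []            = refl
  scaledPush-scale c α (nothing ∷ X) = cong (nothing ∷_) (scaledPush-scale c α X)
  scaledPush-scale c α (just x ∷ X)  = cong₂ _∷_
    (cong just (trans (cong (c ⊙_) (fun-· f α x)) (sym (⊙-assoc c (φ α) (φ x)))))
    (scaledPush-scale c α X)

  scaledPush-nonzero⁻¹ : ∀ {n} c (X : Vec (F T) n) e →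
    lookup (scaledPush c X) e ≢ nothing → lookup X e ≢ nothing
  scaledPush-nonzero⁻¹ c X e nonzero X[e]≡0 =
    nonzero (trans (lookup-scaledPush c X e) (cong (scaled c) X[e]≡0))

  scaled-neg : ∀ c z → scaled c (neg T z) ≡ neg T' (scaled c z)
  scaled-neg c nothing  = refl
  scaled-neg c (just w) = cong just (⊙-fun-ε c w)

  scaled-NF : ∀ c xs → NF T xs → NF T' (List.map (scaled c) xs)
  scaled-NF c xs xs∈N = subst (NF T') (sym (map-∘ {g = Maybe.map (c ⊙_)} {f = Maybe.map φ} xs))
    (NF-map {T'} {T'} (c ⊙_) (T3 T' c) (List.map (Maybe.map φ) xs)
      (NF-map {T} {T'} φ (fun-N f) xs xs∈N))

  map-scaled-lookup-neg : ∀ {n} c (X Z : Vec (F T) n) g →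
    List.map (scaled c) (lookup X g ∷ neg T (lookup Z g) ∷ []) ≡
    lookup (scaledPush c X) g ∷ neg T' (lookup (scaledPush c Z) g) ∷ []
  map-scaled-lookup-neg c X Z g = cong₂ _∷_ (sym (lookup-scaledPush c X g))
    (cong (_∷ []) (trans (scaled-neg c (lookup Z g)) (cong (neg T') (sym (lookup-scaledPush c Z g)))))

  opposite-rescaling : ∀ c d x y → c ⊙ φ x ≡ ε T' ⊙ (d ⊙ φ y) →
                       ∃[ α ] (d ≡ c ⊙ φ α × x ≡ ε T * (α * y))
  opposite-rescaling c d x y opposite = α , d≡cα , sym εαy≡x
    where
      open ≡-Reasoning
      β = inv T (ε T) * x
      α = β * inv T y
      αy≡β : α * y ≡ β
      αy≡β = G.//-rightDividesˡ y β
      εαy≡x : ε T * (α * y) ≡ x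
      εαy≡x = trans (cong (ε T *_) αy≡β) (G.\\-leftDividesˡ (ε T) x)
      dy≡cβ : d ⊙ φ y ≡ c ⊙ φ β
      dy≡cβ = G'.∙-cancelˡ (ε T') _ _ (begin
        ε T' ⊙ (d ⊙ φ y)  ≡⟨ opposite ⟨
        c ⊙ φ x           ≡⟨ cong (λ u → c ⊙ φ u) (G.\\-leftDividesˡ (ε T) x) ⟨
        c ⊙ φ (ε T * β)   ≡⟨ ⊙-fun-ε c β ⟩
        ε T' ⊙ (c ⊙ φ β)  ∎)
      d≡cα : d ≡ c ⊙ φ α
      d≡cα = G'.∙-cancelʳ (φ y) d (c ⊙ φ α) (begin
        d ⊙ φ y          ≡⟨ dy≡cβ ⟩
        c ⊙ φ β          ≡⟨ cong (λ u → c ⊙ φ u) αy≡β ⟨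
        c ⊙ φ (α * y)    ≡⟨ cong (c ⊙_) (fun-· f α y) ⟩
        c ⊙ (φ α ⊙ φ y)  ≡⟨ ⊙-assoc c (φ α) (φ y) ⟨
        c ⊙ φ α ⊙ φ y    ∎)

  module _ {n : ℕ} (C : Vec (F T) n → Set) where

    private
      C' = pushCircuits f C

    pull-supports : ∀ {Ys} → All C' Ys → ∃[ Xs ] (All C Xs × List.map support Ys ≡ List.map support Xs)
    pull-supports []                           = [] , [] , refl
    pull-supports ((c , X , X∈C , refl) ∷ Ys∈C') =
      let (Xs , Xs∈C , Ys≈Xs) = pull-supports Ys∈C'
      in X ∷ Xs , X∈C ∷ Xs∈C , cong₂ _∷_ (support-scaledPush c X) Ys≈Xs

    push-supports : ∀ {Xs} → All C Xs → ∃[ Ys ] (All C' Ys × List.map support Ys ≡ List.map support Xs)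
    push-supports []                         = [] , [] , refl
    push-supports {X ∷ _} (X∈C ∷ Xs∈C) =
      let (Ys , Ys∈C' , Ys≈Xs) = push-supports Xs∈C
      in scaledPush (one T') X ∷ Ys , (one T' , X , X∈C , refl) ∷ Ys∈C' ,
         cong₂ _∷_ (support-scaledPush (one T') X) Ys≈Xs

    isUnion-pull : ∀ {S} → IsUnion T' C' S → IsUnion T C S
    isUnion-pull (Ys , Ys∈C' , S≡⋃Ys) =
      let (Xs , Xs∈C , Ys≈Xs) = pull-supports Ys∈C' in Xs , Xs∈C , trans S≡⋃Ys (cong ⋃ Ys≈Xs)

    isUnion-push : ∀ {S} → IsUnion T C S → IsUnion T' C' S
    isUnion-push (Xs , Xs∈C , S≡⋃Xs) =
      let (Ys , Ys∈C' , Ys≈Xs) = push-supports Xs∈C in Ys , Ys∈C' , trans S≡⋃Xs (cong ⋃ (sym Ys≈Xs))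

    chain-pull : ∀ {S m} → Chain T' C' S m → Chain T C S m
    chain-pull (base S) = base (isUnion-pull S)
    chain-pull (step chain S' S⊂S') = step (chain-pull chain) (isUnion-pull S') S⊂S'

    chain-push : ∀ {S m} → Chain T C S m → Chain T' C' S m
    chain-push (base S) = base (isUnion-push S)
    chain-push (step chain S' S⊂S') = step (chain-push chain) (isUnion-push S') S⊂S'

    hasHeight-pull : ∀ {S h} → HasHeight T' C' S h → HasHeight T C S h
    hasHeight-pull (chain , maximal) = chain-pull chain , λ m → maximal m ∘ chain-push

    modularPair-pull : ∀ {X Y X' Y'} → support X ≡ support X' → support Y ≡ support Y' →
                       ModularPair T' C' X' Y' → ModularPair T C X Y
    modularPair-pull sX sY (X'≢Y' , noSmaller) =
      (λ X≡Y → X'≢Y' (trans (sym sX) (trans X≡Y sY))) ,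
      λ (X₂ , Y₂ , X₂∈C , Y₂∈C , X₂≢Y₂ , X₂Y₂⊂XY) → noSmaller
        ( scaledPush (one T') X₂ , scaledPush (one T') Y₂
        , (one T' , X₂ , X₂∈C , refl) , (one T' , Y₂ , Y₂∈C , refl)
        , (λ eq → X₂≢Y₂ (trans (sym (support-scaledPush _ X₂)) (trans eq (support-scaledPush _ Y₂))))
        , subst₂ _⊂_ (sym (cong₂ _∪_ (support-scaledPush _ X₂) (support-scaledPush _ Y₂)))
                     (cong₂ _∪_ sX sY) X₂Y₂⊂XY )

    realign-opposite : C1 T C → ∀ {X Y'} c e → C' Y' →
                       lookup (scaledPush c X) e ≡ neg T' (lookup Y' e) →
                       lookup (scaledPush c X) e ≢ nothing →
                       ∃[ Y ] (C Y × Y' ≡ scaledPush c Y × lookup X e ≡ neg T (lookup Y e))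
    realign-opposite c1 {X} c e (d , Y , Y∈C , refl) opposite nonzero
      rewrite lookup-scaledPush c X e | lookup-scaledPush d Y e
      with lookup X e | lookup Y e in Y[e]
    ... | nothing | _      = ⊥-elim (nonzero refl)
    ... | just x  | nothing = ⊥-elim (nonzero opposite)
    ... | just x  | just y  =
      let (α , d≡cα , x≡-αy) = opposite-rescaling c d x y (just-injective opposite)
      in scale T α Y , c1 α Y Y∈C ,
         trans (cong (λ u → scaledPush u Y) d≡cα) (sym (scaledPush-scale c α Y)) ,
         trans (cong just x≡-αy)
               (cong (neg T) (sym (trans (lookup-map e _ Y) (cong (Maybe.map (α *_)) Y[e]))))

    pushCircuits-C0 : C0 T C → C0 T' C'
    pushCircuits-C0 c0 (c , X , X∈C , 0≡cX) = c0 (subst C X≡0 X∈C)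
      where
        X≡0 = map-map≡nothings⇒≡nothings φ X
                (map-map≡nothings⇒≡nothings (c ⊙_) (push f X) (sym 0≡cX))

    pushCircuits-C1 : C1 T' C'
    pushCircuits-C1 α _ (c , X , X∈C , refl) = α ⊙ c , X , X∈C , scale-scaledPush α c X

    pushCircuits-C2 : C2 T C → C2 T' C'
    pushCircuits-C2 c2 _ _ (a , X₁ , X₁∈C , refl) (b , X₂ , X₂∈C , refl) X₁⊆X₂ =
      let (α , X₁≡αX₂) = c2 X₁ X₂ X₁∈C X₂∈C
                           (subst₂ _⊆_ (support-scaledPush a X₁) (support-scaledPush b X₂) X₁⊆X₂)
          β = a ⊙ φ α ⊙ inv T' b
      in β , (begin
        scaledPush a X₁               ≡⟨ cong (scaledPush a) X₁≡αX₂ ⟩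
        scaledPush a (scale T α X₂)   ≡⟨ scaledPush-scale a α X₂ ⟩
        scaledPush (a ⊙ φ α) X₂       ≡⟨ cong (λ u → scaledPush u X₂) (G'.//-rightDividesˡ b (a ⊙ φ α)) ⟨
        scaledPush (β ⊙ b) X₂         ≡⟨ scale-scaledPush β b X₂ ⟨
        scale T' β (scaledPush b X₂)  ∎)
      where open ≡-Reasoning

    pushCircuits-C3w : C1 T C → C3w T C → C3w T' C'
    pushCircuits-C3w c1 c3w _ Y' e (c , X , X∈C , refl) Y'∈C' modular opposite nonzero =
      let (Y , Y∈C , Y'≡cY , X[e]≡-Y[e]) = realign-opposite c1 {X} c e Y'∈C' opposite nonzero
          modular' = modularPair-pull (sym (support-scaledPush c X))
                       (trans (sym (support-scaledPush c Y)) (cong support (sym Y'≡cY))) modular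
          (Z , Z∈C , Z[e]≡0 , eliminated) =
            c3w X Y e X∈C Y∈C modular' X[e]≡-Y[e] (scaledPush-nonzero⁻¹ c X e nonzero)
      in scaledPush c Z , (c , Z , Z∈C , refl) ,
         trans (lookup-scaledPush c Z e) (cong (scaled c) Z[e]≡0) ,
         λ g → subst (NF T')
           (cong₂ _∷_ (sym (lookup-scaledPush c X g))
             (trans (map-scaled-lookup-neg c Y Z g)
                    (cong (λ V → lookup V g ∷ neg T' (lookup (scaledPush c Z) g) ∷ []) (sym Y'≡cY))))
           (scaled-NF c (lookup X g ∷ lookup Y g ∷ neg T (lookup Z g) ∷ []) (eliminated g))

    pushCircuits-C3 : C1 T C → C3 T C → C3 T' C'
    pushCircuits-C3 c1 c3 k Xs' _ es Xs'∈C' (c , X , X∈C , refl) height X⊈⋃Xs' separating opposite =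
      let (Z , Z∈C , Z[es]≡0 , eliminated) =
            c3 k Xs X es Xs∈C X∈C height' X⊈⋃Xs separating' opposite'
      in scaledPush c Z , (c , Z , Z∈C , refl) ,
         (λ i → trans (lookup-scaledPush c Z (es i)) (cong (scaled c) (Z[es]≡0 i))) ,
         λ g → subst (NF T') (sum≡ Z g)
                 (scaled-NF c (List.tabulate (λ i → lookup (Xs i) g) ++ (lookup X g ∷ neg T (lookup Z g) ∷ []))
                            (eliminated g))
      where
        aligned : ∀ i → ∃[ Y ] (C Y × Xs' i ≡ scaledPush c Y × lookup X (es i) ≡ neg T (lookup Y (es i)))
        aligned i =
          realign-opposite c1 {X} c (es i) (Xs'∈C' i) (proj₁ (opposite i)) (proj₂ (opposite i))

        Xs : Fin k → Vec (F T) n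
        Xs i = proj₁ (aligned i)

        Xs∈C : ∀ i → C (Xs i)
        Xs∈C i = proj₁ (proj₂ (aligned i))

        Xs'≡cXs : ∀ i → Xs' i ≡ scaledPush c (Xs i)
        Xs'≡cXs i = proj₁ (proj₂ (proj₂ (aligned i)))

        opposite' : ∀ i → lookup X (es i) ≡ neg T (lookup (Xs i) (es i)) × lookup X (es i) ≢ nothing
        opposite' i =
          proj₂ (proj₂ (proj₂ (aligned i))) , scaledPush-nonzero⁻¹ c X (es i) (proj₂ (opposite i))

        supports : ∀ i → support (Xs i) ≡ support (Xs' i)
        supports i = trans (sym (support-scaledPush c (Xs i))) (cong support (sym (Xs'≡cXs i)))

        ⋃Xs≡⋃Xs' : ⋃ (List.tabulate (support ∘ Xs)) ≡ ⋃ (List.tabulate (support ∘ Xs'))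
        ⋃Xs≡⋃Xs' = cong ⋃ (tabulate-cong supports)

        height' : HasHeight T C (⋃ (List.tabulate (support ∘ Xs)) ∪ support X) (suc k)
        height' = hasHeight-pull (subst (λ S → HasHeight T' C' S (suc k))
                    (cong₂ _∪_ (sym ⋃Xs≡⋃Xs') (support-scaledPush c X)) height)

        X⊈⋃Xs : ¬ (support X ⊆ ⋃ (List.tabulate (support ∘ Xs)))
        X⊈⋃Xs = X⊈⋃Xs' ∘ subst₂ _⊆_ (sym (support-scaledPush c X)) ⋃Xs≡⋃Xs'

        separating' : ∀ i → es i ∈ support X × es i ∈ support (Xs i) ×
                            (∀ j → j ≢ i → es i ∉ support (Xs j))
        separating' i =
          let (e∈X' , e∈Xs'i , e∉Xs'j) = separating i
          in subst (es i ∈_) (support-scaledPush c X) e∈X' ,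
             subst (es i ∈_) (sym (supports i)) e∈Xs'i ,
             λ j j≢i → e∉Xs'j j j≢i ∘ subst (es i ∈_) (supports j)

        entries≡ : ∀ g i → scaled c (lookup (Xs i) g) ≡ lookup (Xs' i) g
        entries≡ g i = trans (sym (lookup-scaledPush c (Xs i) g)) (cong (λ V → lookup V g) (sym (Xs'≡cXs i)))

        sum≡ : ∀ Z g →
          List.map (scaled c) (List.tabulate (λ i → lookup (Xs i) g) ++ (lookup X g ∷ neg T (lookup Z g) ∷ [])) ≡
          List.tabulate (λ i → lookup (Xs' i) g) ++
            (lookup (scaledPush c X) g ∷ neg T' (lookup (scaledPush c Z) g) ∷ [])
        sum≡ Z g = trans (map-++ (scaled c) (List.tabulate (λ i → lookup (Xs i) g)) _)
          (cong₂ _++_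
            (trans (map-tabulate (λ i → lookup (Xs i) g) (scaled c)) (tabulate-cong (entries≡ g)))
            (map-scaled-lookup-neg c X Z g))

lemma3p34 : ∀ {T T' : Tract} (f : TractHom T T') (n : ℕ) (C : Vec (F T) n → Set) →
    (IsStrongMatroid T C → IsStrongMatroid T' (pushCircuits f C)) ×
    (IsWeakMatroid T C → IsWeakMatroid T' (pushCircuits f C))
lemma3p34 f n C =
  (λ (c0 , c1 , c2 , c3) →
     pushCircuits-C0 f C c0 , pushCircuits-C1 f C , pushCircuits-C2 f C c2 , pushCircuits-C3 f C c1 c3) ,
  (λ (c0 , c1 , c2 , c3w) →
     pushCircuits-C0 f C c0 , pushCircuits-C1 f C , pushCircuits-C2 f C c2 , pushCircuits-C3w f C c1 c3w)
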